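{- Let $G$ be a finite simple connected graph that is $\mathbb{Z}$-vertex magic. Then there exists $k \in \mathbb{N}$ such that $G$ is $\mathbb{Z}_m$-vertex magic for all integers $m \ge k$.
   Context: For a non-trivial Abelian group $A$ (not necessarily finite), a graph $G$ is $A$-vertex magic if there exist a labeling $l : V(G) \to A\setminus\{0\}$ and $\mu \in A$ such that $w(v)=\sum_{u \in N_G(v)} l(u) = \mu$ for every vertex $v$ of $G$, where $N_G(v)=\{u \in V(G) : uv \in E(G)\}$ is the open neighborhood of $v$. Such $l$ is called an $A$-vertex magic labeling. $\mathbb{Z}_m$ denotes the cyclic group of order $m$. -}

module Defs where

open import Data.Nat using (ℕ; zero; suc)
open import Data.Fin using (Fin)
open import Data.Bool using (Bool; true; false; if_then_else_)
open import Data.Integer using (ℤ; _+_; _-_; +_; 0ℤ)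
open import Data.Integer.Divisibility using (_∣_)
open import Data.Product using (Σ; _×_; ∃)
open import Relation.Binary.PropositionalEquality using (_≡_; _≢_)
open import Relation.Nullary using (¬_)

record Graph (n : ℕ) : Set where
  field
    adj     : Fin n → Fin n → Bool
    sym     : ∀ u v → adj u v ≡ adj v u
    irrefl  : ∀ v → adj v v ≡ false
open Graph public

sumFin : (n : ℕ) → (Fin n → ℤ) → ℤ
sumFin zero    f = 0ℤ
sumFin (suc n) f = f Fin.zero + sumFin n (λ i → f (Fin.suc i))

data Reach {n : ℕ} (G : Graph n) : Fin n → Fin n → Set where
  here : ∀ v → Reach G v v
  step : ∀ u v w → adj G u v ≡ true → Reach G v w → Reach G u w

Connected : {n : ℕ} → Graph n → Set
Connected G = ∀ u v → Reach G u v

weight : {n : ℕ} → Graph n → (Fin n → ℤ) → Fin n → ℤ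
weight {n} G l v = sumFin n (λ u → if adj G v u then l u else 0ℤ)

ZVertexMagic : {n : ℕ} → Graph n → Set
ZVertexMagic {n} G =
  Σ (Fin n → ℤ) λ l → Σ ℤ λ μ →
    (∀ v → l v ≢ 0ℤ) × (∀ v → weight G l v ≡ μ)

-- ℤ_m-vertex magic, with ℤ_m = ℤ / mℤ represented by integers modulo m:
-- labels are nonzero in ℤ_m (not divisible by m) and every weight equals μ in ℤ_m.
ZmVertexMagic : {n : ℕ} → ℕ → Graph n → Set
ZmVertexMagic {n} m G =
  Σ (Fin n → ℤ) λ l → Σ ℤ λ μ →
    (∀ v → ¬ ((+ m) ∣ l v)) × (∀ v → (+ m) ∣ (weight G l v - μ))

-- Reducing a ℤ-vertex magic labeling modulo m keeps every weight equal to
-- the magic constant, and keeps every label nonzero as soon as m exceeds all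
-- the |l(v)|; so k = 1 + Σ |l(v)| works.
module Submission where

open import Defs hiding (sym)
open import Data.Nat using (ℕ; zero; suc; _+_; _≤_; _<_; _≥_; s≤s; ≢-nonZero)
open import Data.Nat.Properties using (m≤m+n; m≤n+m; ≤-trans; <-≤-trans)
open import Data.Nat.Divisibility using (>⇒∤; _∣0)
open import Data.Fin using (Fin)
open import Data.Integer using (ℤ; ∣_∣; +_; _-_; 0ℤ)
open import Data.Integer.Properties using (∣i∣≡0⇒i≡0; +-inverseʳ)
open import Data.Integer.Divisibility using (_∣_)
open import Data.Product using (∃; _,_)
open import Relation.Binary.PropositionalEquality using (_≡_; _≢_; subst; sym)
open import Relation.Nullary using (¬_)

sumAbs : (n : ℕ) → (Fin n → ℤ) → ℕ
sumAbs zero    f = 0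
sumAbs (suc n) f = ∣ f Fin.zero ∣ + sumAbs n (λ i → f (Fin.suc i))

∣f∣≤sumAbs : (n : ℕ) (f : Fin n → ℤ) (v : Fin n) → ∣ f v ∣ ≤ sumAbs n f
∣f∣≤sumAbs (suc n) f Fin.zero    = m≤m+n _ _
∣f∣≤sumAbs (suc n) f (Fin.suc v) =
  ≤-trans (∣f∣≤sumAbs n (λ i → f (Fin.suc i)) v) (m≤n+m _ _)

nonzero∧∣i∣<m⇒m∤i : ∀ {m : ℕ} {i : ℤ} → i ≢ 0ℤ → ∣ i ∣ < m → ¬ (+ m ∣ i)
nonzero∧∣i∣<m⇒m∤i i≢0 ∣i∣<m =
  >⇒∤ {{≢-nonZero (λ ∣i∣≡0 → i≢0 (∣i∣≡0⇒i≡0 ∣i∣≡0))}} ∣i∣<m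

m∣i-i : ∀ (m : ℕ) (i : ℤ) → + m ∣ (i - i)
m∣i-i m i = subst (+ m ∣_) (sym (+-inverseʳ i)) (m ∣0)

ZVertexMagic⇒ZmVertexMagic :
  ∀ {n : ℕ} (G : Graph n) (l : Fin n → ℤ) (μ : ℤ) →
  (∀ v → l v ≢ 0ℤ) → (∀ v → weight G l v ≡ μ) →
  ∀ (m : ℕ) → (∀ v → ∣ l v ∣ < m) → ZmVertexMagic m G
ZVertexMagic⇒ZmVertexMagic G l μ l≢0 magic m ∣l∣<m =
  l , μ ,
  (λ v → nonzero∧∣i∣<m⇒m∤i (l≢0 v) (∣l∣<m v)) ,
  (λ v → subst (λ w → + m ∣ (w - μ)) (sym (magic v)) (m∣i-i m μ))

mainTheorem1 : ∀ {n : ℕ} (G : Graph n) → Connected G → ZVertexMagic G →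
    ∃ λ (k : ℕ) → ∀ (m : ℕ) → m ≥ k → ZmVertexMagic m G
mainTheorem1 {n} G _ (l , μ , l≢0 , magic) =
  suc (sumAbs n l) , λ m m>Σ∣l∣ →
    ZVertexMagic⇒ZmVertexMagic G l μ l≢0 magic m
      (λ v → <-≤-trans (s≤s (∣f∣≤sumAbs n l v)) m>Σ∣l∣)
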